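{- Let $x$ be a positive integer, let $p_1<p_2<p_3<\cdots$ be the sequence of all prime numbers in increasing order, and for each $k\ge1$ let $N_k=2^{p_k-1}(2^{p_k}-1)$. Then $$\lim_{k\to\infty} I(x,N_k)=\frac{2^x}{2^x-1}.$$
   Context: For positive integers $x,n$, $\sigma_x(n)=\sum_{d\mid n} d^x$ and $I(x,n)=\sigma_x(n)/n^x$. -}

module Defs where

open import Data.Nat as ℕ using (ℕ; zero; suc; _^_; _∸_; _*_)
open import Data.Nat.Divisibility using (_∣?_)
open import Data.Nat.Primality using (Prime)
open import Data.List using (List; map; filter; upTo)
open import Data.Nat.ListAction using (sum)
open import Data.Integer using (+_)
open import Data.Rational using (ℚ; 0ℚ; _/_; _-_; ∣_∣; _<_)
open import Data.Product using (∃; _×_)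

divisors : ℕ → List ℕ
divisors n = filter (_∣? n) (map suc (upTo n))

σ : ℕ → ℕ → ℕ
σ x n = sum (map (λ d → d ^ x) (divisors n))

-- a / b as a rational; convention: value 0 when b = 0 (never used here)
frac : ℕ → ℕ → ℚ
frac a zero    = 0ℚ
frac a (suc b) = (+ a) / suc b

I : ℕ → ℕ → ℚ
I x n = frac (σ x n) (n ^ x)

N : ℕ → ℕ
N p = 2 ^ (p ∸ 1) * (2 ^ p ∸ 1)

-- p enumerates all primes in strictly increasing order (p 0 = first prime)
IsPrimeEnumeration : (ℕ → ℕ) → Set
IsPrimeEnumeration p =
  (∀ k → Prime (p k)) × (∀ k → p k ℕ.< p (suc k)) × (∀ q → Prime q → ∃ λ k → p k ≡ q)
  where open import Relation.Binary.PropositionalEquality using (_≡_)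

ConvergesTo : (ℕ → ℚ) → ℚ → Set
ConvergesTo a L = ∀ (ε : ℚ) → 0ℚ < ε → ∃ λ K → ∀ k → K ℕ.≤ k → ∣ a k - L ∣ < ε

module Submission where

-- For a prime q put M = 2^q - 1 and N q = 2^(q-1) M.  As M is odd,
--   σ_x(N q) = G · σ_x(M)   with G = 1 + 2^x + … + 2^(x(q-1)),
--   (N q)^x  = V · M^x      with V = 2^(x(q-1)),
-- and (2^x - 1) G + 1 = 2^x V, so G / V tends to 2^x / (2^x - 1).  It remains
-- that σ_x(M) / M^x tends to 1.  Every prime factor r of M exceeds q (the order
-- of 2 modulo r divides q and is smaller than r), so M has ℓ prime factors,
-- all ≥ q + 1, with ℓ · log₂(q + 1) < q, and
--   1 ≤ σ_x(M) / M^x ≤ (1 + 1/(q+1))^ℓ ≤ (q+1) / (q+1-ℓ).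

open import Defs
open import Data.Nat using (ℕ; zero; suc; _+_; _*_; _^_; _∸_; _≤_; _<_; _≥_; NonZero; pred; z≤n; s≤s; >-nonZero; ≢-nonZero)
open import Data.Nat.Properties
open import Data.Nat.Divisibility
open import Data.Nat.DivMod using (_/_; _%_; m*n/n≡m; m*[n/m]≡n; m≡m%n+[m/n]*n; m%n<n)
open import Data.Nat.Primality using (Prime; prime⇒irreducible; prime⇒nonZero; prime[2]; ¬prime[1]; productOfPrimes≢0; euclidsLemma)
open import Data.Nat.Primality.Factorisation using (factorise; PrimeFactorisation)
open import Data.Nat.Coprimality using (Coprime; coprime-divisor; prime⇒coprime; coprime-Bézout)
open import Data.Nat.GCD using (module Bézout)
open import Data.Nat.ListAction using (sum; product)
open import Data.Nat.ListAction.Properties using (sum-++; ∈⇒∣product)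
open import Data.Nat.Solver using (module +-*-Solver)
open import Data.List using (List; []; _∷_; map; filter; upTo; _∷ʳ_; _++_; length)
open import Data.List.Properties using (applyUpTo-∷ʳ; map-++)
open import Data.List.Relation.Unary.All as All using (All; []; _∷_)
open import Data.Fin using (Fin; toℕ; fromℕ<)
open import Data.Fin.Properties using (pigeonhole; toℕ-fromℕ<; toℕ<n)
open import Data.Rational as Q using (ℚ; mkℚ; 0ℚ)
import Data.Rational.Properties as QP
import Data.Rational.Unnormalised as ℚᵘ
import Data.Rational.Unnormalised.Properties as ℚᵘP
import Data.Integer as Z
import Data.Integer.Properties as ZP
open import Data.Product using (∃; ∃₂; _×_; _,_)
open import Data.Sum using (inj₁; inj₂)
open import Relation.Nullary using (Dec; yes; no; ¬_; ¬?; contradiction)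
open import Relation.Binary.PropositionalEquality
open +-*-Solver using (solve; _:=_; _:+_; _:*_; con)

∑ : (ℕ → ℕ) → ℕ → ℕ
∑ f zero = 0
∑ f (suc n) = ∑ f n + f (suc n)

∑-cong : ∀ {f g} n → (∀ d → 1 ≤ d → d ≤ n → f d ≡ g d) → ∑ f n ≡ ∑ g n
∑-cong zero f≡g = refl
∑-cong (suc n) f≡g =
  cong₂ _+_ (∑-cong n (λ d 1≤d d≤n → f≡g d 1≤d (m≤n⇒m≤1+n d≤n))) (f≡g (suc n) (s≤s z≤n) ≤-refl)

∑-mono : ∀ {f g} n → (∀ d → f d ≤ g d) → ∑ f n ≤ ∑ g n
∑-mono zero f≤g = z≤n
∑-mono (suc n) f≤g = +-mono-≤ (∑-mono n f≤g) (f≤g (suc n))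

∑-+ : ∀ f g n → ∑ (λ d → f d + g d) n ≡ ∑ f n + ∑ g n
∑-+ f g zero = refl
∑-+ f g (suc n) rewrite ∑-+ f g n =
  solve 4 (λ a b c d → (a :+ b) :+ (c :+ d) := (a :+ c) :+ (b :+ d)) refl (∑ f n) (∑ g n) (f (suc n)) (g (suc n))

∑-* : ∀ c f n → ∑ (λ d → c * f d) n ≡ c * ∑ f n
∑-* c f zero = sym (*-zeroʳ c)
∑-* c f (suc n) rewrite ∑-* c f n = sym (*-distribˡ-+ c (∑ f n) (f (suc n)))

∑-zero : ∀ f n → (∀ d → 1 ≤ d → d ≤ n → f d ≡ 0) → ∑ f n ≡ 0
∑-zero f zero f≡0 = refl
∑-zero f (suc n) f≡0 =
  cong₂ _+_ (∑-zero f n (λ d 1≤d d≤n → f≡0 d 1≤d (m≤n⇒m≤1+n d≤n))) (f≡0 (suc n) (s≤s z≤n) ≤-refl)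

∑-split : ∀ f n k → ∑ f (n + k) ≡ ∑ f n + ∑ (λ i → f (n + i)) k
∑-split f n zero rewrite +-identityʳ n = sym (+-identityʳ _)
∑-split f n (suc k) rewrite +-suc n k | ∑-split f n k = +-assoc (∑ f n) _ _

when : {P : Set} → Dec P → ℕ → ℕ
when (yes _) v = v
when (no _) v = 0

when-true : {P : Set} (P? : Dec P) {v : ℕ} → P → when P? v ≡ v
when-true (yes _) _ = refl
when-true (no ¬p) p = contradiction p ¬p

when-false : {P : Set} (P? : Dec P) {v : ℕ} → ¬ P → when P? v ≡ 0
when-false (yes p) ¬p = contradiction p ¬p
when-false (no _) _ = refl

when-zero : {P : Set} (P? : Dec P) → when P? 0 ≡ 0
when-zero (yes _) = refl
when-zero (no _) = refl

when-iff : {P Q : Set} (P? : Dec P) (Q? : Dec Q) {v : ℕ} → (P → Q) → (Q → P) → when P? v ≡ when Q? v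
when-iff (yes _) (yes _) to from = refl
when-iff (yes p) (no ¬q) to from = contradiction (to p) ¬q
when-iff (no ¬p) (yes q) to from = contradiction (from q) ¬p
when-iff (no _) (no _) to from = refl

when-mono : {P : Set} (P? : Dec P) {v w : ℕ} → v ≤ w → when P? v ≤ when P? w
when-mono (yes _) v≤w = v≤w
when-mono (no _) v≤w = z≤n

when≤ : {P : Set} (P? : Dec P) (v : ℕ) → when P? v ≤ v
when≤ (yes _) v = ≤-refl
when≤ (no _) v = z≤n

sum-filter : ∀ {P : ℕ → Set} (P? : ∀ d → Dec (P d)) (g : ℕ → ℕ) ds →
  sum (map g (filter P? ds)) ≡ sum (map (λ d → when (P? d) (g d)) ds)
sum-filter P? g [] = refl
sum-filter P? g (d ∷ ds) with P? d
... | yes _ = cong (g d +_) (sum-filter P? g ds)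
... | no _ = sum-filter P? g ds

sum-upTo-suc : ∀ h n → sum (map h (map suc (upTo n))) ≡ ∑ h n
sum-upTo-suc h zero = refl
sum-upTo-suc h (suc n) = begin
  sum (map h (map suc (upTo (suc n))))
    ≡⟨ cong (λ l → sum (map h (map suc l))) (sym (applyUpTo-∷ʳ (λ i → i) n)) ⟩
  sum (map h (map suc (upTo n ∷ʳ n)))
    ≡⟨ cong (λ l → sum (map h l)) (map-++ suc (upTo n) (n ∷ [])) ⟩
  sum (map h (map suc (upTo n) ++ suc n ∷ []))
    ≡⟨ cong sum (map-++ h (map suc (upTo n)) (suc n ∷ [])) ⟩
  sum (map h (map suc (upTo n)) ++ h (suc n) ∷ [])
    ≡⟨ sum-++ (map h (map suc (upTo n))) (h (suc n) ∷ []) ⟩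
  sum (map h (map suc (upTo n))) + (h (suc n) + 0)
    ≡⟨ cong₂ _+_ (sum-upTo-suc h n) (+-identityʳ _) ⟩
  ∑ h (suc n) ∎
  where open ≡-Reasoning

divisorSum : ℕ → (ℕ → ℕ) → ℕ → ℕ
divisorSum n g B = ∑ (λ d → when (d ∣? n) (g d)) B

σ≡divisorSum : ∀ x n → σ x n ≡ divisorSum n (_^ x) n
σ≡divisorSum x n =
  trans (sum-filter (_∣? n) (_^ x) (map suc (upTo n))) (sum-upTo-suc (λ d → when (d ∣? n) (d ^ x)) n)

divisorSum-beyond : ∀ n g B → .{{NonZero n}} → n ≤ B → divisorSum n g B ≡ divisorSum n g n
divisorSum-beyond n g B n≤B = begin
  divisorSum n g B                                     ≡⟨ cong (divisorSum n g) (sym (m+[n∸m]≡n n≤B)) ⟩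
  divisorSum n g (n + (B ∸ n))                         ≡⟨ ∑-split _ n (B ∸ n) ⟩
  divisorSum n g n + ∑ (λ i → when ((n + i) ∣? n) (g (n + i))) (B ∸ n)
    ≡⟨ cong (divisorSum n g n +_) (∑-zero _ (B ∸ n) beyond) ⟩
  divisorSum n g n + 0                                 ≡⟨ +-identityʳ _ ⟩
  divisorSum n g n ∎
  where
  open ≡-Reasoning
  beyond : ∀ i → 1 ≤ i → i ≤ B ∸ n → when ((n + i) ∣? n) (g (n + i)) ≡ 0
  beyond i 1≤i _ = when-false ((n + i) ∣? n) (λ n+i∣n → <⇒≱ (m<m+n n 1≤i) (∣⇒≤ n+i∣n))

∑-multiples : ∀ r .{{_ : NonZero r}} (h : ℕ → ℕ) n → ∑ (λ d → when (r ∣? d) (h (d / r))) (r * n) ≡ ∑ h n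
∑-multiples r h zero rewrite *-zeroʳ r = refl
∑-multiples r@(suc r') h (suc n) = begin
  ∑ f (r * suc n)                       ≡⟨ cong (∑ f) (trans (*-suc r n) (+-comm r (r * n))) ⟩
  ∑ f (r * n + r)                       ≡⟨ ∑-split f (r * n) r ⟩
  ∑ f (r * n) + ∑ (λ i → f (r * n + i)) r ≡⟨ cong₂ _+_ (∑-multiples r h n) lastBlock ⟩
  ∑ h n + h (suc n) ∎
  where
  open ≡-Reasoning
  f : ℕ → ℕ
  f d = when (r ∣? d) (h (d / r))
  rn+r≡ : r * n + r ≡ suc n * r
  rn+r≡ = trans (+-comm (r * n) r) (cong (r +_) (*-comm r n))
  -- among r n + 1, …, r n + r only the last number is a multiple of r
  lastBlock : ∑ (λ i → f (r * n + i)) r ≡ h (suc n)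
  lastBlock = cong₂ _+_
    (∑-zero _ r' (λ i 1≤i i≤r' → when-false (r ∣? (r * n + i))
       (λ r∣ → <⇒≱ (s≤s i≤r') (∣⇒≤ {{>-nonZero 1≤i}} (∣m+n∣m⇒∣n r∣ (m∣m*n n))))))
    (trans (when-true (r ∣? (r * n + r)) (subst (r ∣_) (sym rn+r≡) (n∣m*n (suc n))))
       (cong h (trans (cong (_/ r) rn+r≡) (m*n/n≡m (suc n) r))))

*-^ : ∀ a b x → (a * b) ^ x ≡ a ^ x * b ^ x
*-^ a b zero = refl
*-^ a b (suc x) rewrite *-^ a b x =
  solve 4 (λ a b c d → (a :* b) :* (c :* d) := (a :* c) :* (b :* d)) refl a b (a ^ x) (b ^ x)

prime∤-divisor : ∀ {r n d} → Prime r → ¬ r ∣ d → d ∣ r * n → d ∣ n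
prime∤-divisor {r} {n} {d} pr r∤d = coprime-divisor coprime
  where
  coprime : Coprime d r
  coprime (i∣d , i∣r) with prime⇒irreducible pr i∣r
  ... | inj₁ i≡1 = i≡1
  ... | inj₂ refl = contradiction i∣d r∤d

σ⊥ : ℕ → ℕ → ℕ → ℕ
σ⊥ x r n = divisorSum n (λ d → when (¬? (r ∣? d)) (d ^ x)) n

-- Divisors of r n: those not divisible by r divide n; the others are r e with e ∣ n.
divisor-split : ∀ x r n d → .{{_ : NonZero r}} → Prime r →
  when (d ∣? (r * n)) (d ^ x) ≡
    when (d ∣? n) (when (¬? (r ∣? d)) (d ^ x)) + when (r ∣? d) (when ((d / r) ∣? n) ((r * (d / r)) ^ x))
divisor-split x r n d pr with r ∣? d
... | no r∤d = begin
  when (d ∣? (r * n)) (d ^ x) ≡⟨ when-iff (d ∣? (r * n)) (d ∣? n) (prime∤-divisor pr r∤d) (∣n⇒∣m*n r) ⟩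
  when (d ∣? n) (d ^ x)       ≡⟨ sym (+-identityʳ _) ⟩
  when (d ∣? n) (d ^ x) + 0 ∎
  where open ≡-Reasoning
... | yes r∣d = begin
  when (d ∣? (r * n)) (d ^ x)               ≡⟨ when-iff (d ∣? (r * n)) ((d / r) ∣? n) to from ⟩
  when ((d / r) ∣? n) (d ^ x)               ≡⟨ cong (λ e → when ((d / r) ∣? n) (e ^ x)) (sym r[d/r]≡d) ⟩
  when ((d / r) ∣? n) ((r * (d / r)) ^ x)   ≡⟨ cong (_+ when ((d / r) ∣? n) ((r * (d / r)) ^ x)) (sym (when-zero (d ∣? n))) ⟩
  when (d ∣? n) 0 + when ((d / r) ∣? n) ((r * (d / r)) ^ x) ∎
  where
  open ≡-Reasoning
  r[d/r]≡d : r * (d / r) ≡ d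
  r[d/r]≡d = m*[n/m]≡n r∣d
  to : d ∣ r * n → d / r ∣ n
  to d∣rn = *-cancelˡ-∣ r (subst (_∣ r * n) (sym r[d/r]≡d) d∣rn)
  from : d / r ∣ n → d ∣ r * n
  from d/r∣n = subst (_∣ r * n) r[d/r]≡d (*-monoʳ-∣ r d/r∣n)

σ-prime-mul : ∀ x r n → Prime r → .{{NonZero n}} → σ x (r * n) ≡ σ⊥ x r n + r ^ x * σ x n
σ-prime-mul x r n pr = begin
  σ x (r * n)                          ≡⟨ σ≡divisorSum x (r * n) ⟩
  divisorSum (r * n) (_^ x) (r * n)    ≡⟨ ∑-cong (r * n) (λ d _ _ → divisor-split x r n d pr) ⟩
  ∑ (λ d → coprimePart d + multiplePart d) (r * n)
    ≡⟨ ∑-+ coprimePart multiplePart (r * n) ⟩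
  ∑ coprimePart (r * n) + ∑ multiplePart (r * n)
    ≡⟨ cong₂ _+_ (divisorSum-beyond n _ (r * n) (m≤n*m n r)) (∑-multiples r h n) ⟩
  σ⊥ x r n + ∑ h n                     ≡⟨ cong (σ⊥ x r n +_) (trans (∑-cong n (λ e _ _ → h≡ e)) (∑-* (r ^ x) _ n)) ⟩
  σ⊥ x r n + r ^ x * divisorSum n (_^ x) n ≡⟨ cong (λ s → σ⊥ x r n + r ^ x * s) (sym (σ≡divisorSum x n)) ⟩
  σ⊥ x r n + r ^ x * σ x n ∎
  where
  open ≡-Reasoning
  instance _ = prime⇒nonZero pr
  coprimePart multiplePart h : ℕ → ℕ
  coprimePart d = when (d ∣? n) (when (¬? (r ∣? d)) (d ^ x))
  h e = when (e ∣? n) ((r * e) ^ x)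
  multiplePart d = when (r ∣? d) (h (d / r))
  h≡ : ∀ e → h e ≡ r ^ x * when (e ∣? n) (e ^ x)
  h≡ e with e ∣? n
  ... | yes _ = *-^ r e x
  ... | no _ = sym (*-zeroʳ (r ^ x))

σ⊥-prime-mul : ∀ x r n → Prime r → .{{NonZero n}} → σ⊥ x r (r * n) ≡ σ⊥ x r n
σ⊥-prime-mul x r n pr = trans (∑-cong (r * n) same) (divisorSum-beyond n _ (r * n) (m≤n*m n r))
  where
  instance _ = prime⇒nonZero pr
  same : ∀ d → 1 ≤ d → d ≤ r * n →
    when (d ∣? (r * n)) (when (¬? (r ∣? d)) (d ^ x)) ≡ when (d ∣? n) (when (¬? (r ∣? d)) (d ^ x))
  same d _ _ with r ∣? d
  ... | yes _ = trans (when-zero (d ∣? (r * n))) (sym (when-zero (d ∣? n)))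
  ... | no r∤d = when-iff (d ∣? (r * n)) (d ∣? n) (prime∤-divisor pr r∤d) (∣n⇒∣m*n r)

σ⊥-coprime : ∀ x r n → ¬ r ∣ n → σ⊥ x r n ≡ σ x n
σ⊥-coprime x r n r∤n = trans (∑-cong n same) (sym (σ≡divisorSum x n))
  where
  same : ∀ d → 1 ≤ d → d ≤ n → when (d ∣? n) (when (¬? (r ∣? d)) (d ^ x)) ≡ when (d ∣? n) (d ^ x)
  same d _ _ with d ∣? n
  ... | yes d∣n = when-true (¬? (r ∣? d)) (λ r∣d → r∤n (∣-trans r∣d d∣n))
  ... | no _ = refl

σ⊥≤σ : ∀ x r n → σ⊥ x r n ≤ σ x n
σ⊥≤σ x r n = subst (σ⊥ x r n ≤_) (sym (σ≡divisorSum x n))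
  (∑-mono n (λ d → when-mono (d ∣? n) (when≤ (¬? (r ∣? d)) (d ^ x))))

σ-prime-mul≤ : ∀ x r n → Prime r → .{{NonZero n}} → σ x (r * n) ≤ (r ^ x + 1) * σ x n
σ-prime-mul≤ x r n pr = begin
  σ x (r * n)              ≡⟨ σ-prime-mul x r n pr ⟩
  σ⊥ x r n + r ^ x * σ x n ≤⟨ +-monoˡ-≤ _ (σ⊥≤σ x r n) ⟩
  σ x n + r ^ x * σ x n    ≡⟨ solve 2 (λ s a → s :+ a :* s := (a :+ con 1) :* s) refl (σ x n) (r ^ x) ⟩
  (r ^ x + 1) * σ x n ∎
  where open ≤-Reasoning

geom : ℕ → ℕ → ℕ
geom w zero = 0
geom w (suc n) = 1 + w * geom w n

geom-closed : ∀ w u n → w ≡ suc u → u * geom w n + 1 ≡ w ^ n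
geom-closed _ u zero refl = cong (_+ 1) (*-zeroʳ u)
geom-closed _ u (suc n) refl = begin
  u * (1 + suc u * g) + 1 ≡⟨ solve 2 (λ u g → u :* (con 1 :+ (con 1 :+ u) :* g) :+ con 1 := (con 1 :+ u) :* (u :* g :+ con 1)) refl u g ⟩
  suc u * (u * g + 1)     ≡⟨ cong (suc u *_) (geom-closed (suc u) u n refl) ⟩
  suc u * suc u ^ n ∎
  where
  open ≡-Reasoning
  g = geom (suc u) n

σ⊥-2^a*odd : ∀ x a M → ¬ 2 ∣ M → .{{NonZero M}} → σ⊥ x 2 (2 ^ a * M) ≡ σ x M
σ⊥-2^a*odd x zero M odd = trans (cong (σ⊥ x 2) (+-identityʳ M)) (σ⊥-coprime x 2 M odd)
σ⊥-2^a*odd x (suc a) M odd = begin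
  σ⊥ x 2 (2 ^ suc a * M)   ≡⟨ cong (σ⊥ x 2) (*-assoc 2 (2 ^ a) M) ⟩
  σ⊥ x 2 (2 * (2 ^ a * M)) ≡⟨ σ⊥-prime-mul x 2 (2 ^ a * M) prime[2] {{m*n≢0 (2 ^ a) M {{m^n≢0 2 a}}}} ⟩
  σ⊥ x 2 (2 ^ a * M)       ≡⟨ σ⊥-2^a*odd x a M odd ⟩
  σ x M ∎
  where open ≡-Reasoning

σ-2^a*odd : ∀ x a M → ¬ 2 ∣ M → .{{NonZero M}} → σ x (2 ^ a * M) ≡ geom (2 ^ x) (suc a) * σ x M
σ-2^a*odd x zero M odd =
  trans (cong (σ x) (+-identityʳ M)) (solve 2 (λ s w → s := (con 1 :+ w :* con 0) :* s) refl (σ x M) (2 ^ x))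
σ-2^a*odd x (suc a) M odd = begin
  σ x (2 ^ suc a * M)   ≡⟨ cong (σ x) (*-assoc 2 (2 ^ a) M) ⟩
  σ x (2 * (2 ^ a * M)) ≡⟨ σ-prime-mul x 2 (2 ^ a * M) prime[2] {{m*n≢0 (2 ^ a) M {{m^n≢0 2 a}}}} ⟩
  σ⊥ x 2 (2 ^ a * M) + 2 ^ x * σ x (2 ^ a * M)
    ≡⟨ cong₂ _+_ (σ⊥-2^a*odd x a M odd) (cong (2 ^ x *_) (σ-2^a*odd x a M odd)) ⟩
  σ x M + 2 ^ x * (geom (2 ^ x) (suc a) * σ x M)
    ≡⟨ solve 3 (λ s w g → s :+ w :* (g :* s) := (con 1 :+ w :* g) :* s) refl (σ x M) (2 ^ x) (geom (2 ^ x) (suc a)) ⟩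
  geom (2 ^ x) (suc (suc a)) * σ x M ∎
  where open ≡-Reasoning

-- n^x is the last term of σ_x(n), so n^x ≤ σ_x(n).
^≤σ : ∀ x n → .{{NonZero n}} → n ^ x ≤ σ x n
^≤σ x n@(suc n') = subst (n ^ x ≤_) (sym (σ≡divisorSum x n))
  (≤-trans (≤-reflexive (sym (when-true (n ∣? n) ∣-refl))) (m≤n+m _ (divisorSum n (_^ x) n')))

m≤m^x : ∀ m x → .{{NonZero m}} → 1 ≤ x → m ≤ m ^ x
m≤m^x m (suc x) _ = subst (_≤ m * m ^ x) (*-identityʳ m) (*-monoʳ-≤ m (m^n>0 m x))

product≥ : ∀ P as → All (P ≤_) as → P ^ length as ≤ product as
product≥ P [] [] = ≤-refl
product≥ P (a ∷ as) (P≤a ∷ P≤as) = *-mono-≤ P≤a (product≥ P as P≤as)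

σ-product≤ : ∀ x → 1 ≤ x → (P : ℕ) (rs : List ℕ) → All Prime rs → All (P ≤_) rs →
  σ x (product rs) * P ^ length rs ≤ product rs ^ x * suc P ^ length rs
σ-product≤ x x≥1 P [] [] [] = ≤-reflexive (cong₂ _*_ (trans σ-1 (sym (^-zeroˡ x))) refl)
  where
  σ-1 : σ x 1 ≡ 1
  σ-1 = trans (σ≡divisorSum x 1) (^-zeroˡ x)
σ-product≤ x x≥1 P (r ∷ rs) (pr ∷ prs) (P≤r ∷ P≤rs) = begin
  σ x (r * n) * (P * P ^ ℓ)                  ≤⟨ *-monoˡ-≤ _ (σ-prime-mul≤ x r n pr) ⟩
  (r ^ x + 1) * σ x n * (P * P ^ ℓ)
    ≡⟨ solve 4 (λ a s p q → a :* s :* (p :* q) := (a :* p) :* (s :* q)) refl (r ^ x + 1) (σ x n) P (P ^ ℓ) ⟩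
  ((r ^ x + 1) * P) * (σ x n * P ^ ℓ)        ≤⟨ *-mono-≤ factor (σ-product≤ x x≥1 P rs prs P≤rs) ⟩
  (r ^ x * suc P) * (n ^ x * suc P ^ ℓ)
    ≡⟨ solve 4 (λ a p b q → (a :* p) :* (b :* q) := (a :* b) :* (p :* q)) refl (r ^ x) (suc P) (n ^ x) (suc P ^ ℓ) ⟩
  (r ^ x * n ^ x) * (suc P * suc P ^ ℓ)      ≡⟨ cong (_* (suc P * suc P ^ ℓ)) (sym (*-^ r n x)) ⟩
  (r * n) ^ x * (suc P * suc P ^ ℓ) ∎
  where
  open ≤-Reasoning
  n = product rs
  ℓ = length rs
  instance _ = productOfPrimes≢0 prs
  instance _ = prime⇒nonZero pr
  -- (1 + r^-x) ≤ (1 + 1/P), as P ≤ r ≤ r^x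
  factor : (r ^ x + 1) * P ≤ r ^ x * suc P
  factor = begin
    (r ^ x + 1) * P   ≡⟨ solve 2 (λ a p → (a :+ con 1) :* p := a :* p :+ p) refl (r ^ x) P ⟩
    r ^ x * P + P     ≤⟨ +-monoʳ-≤ (r ^ x * P) (≤-trans P≤r (m≤m^x r x x≥1)) ⟩
    r ^ x * P + r ^ x ≡⟨ solve 2 (λ a p → a :* p :+ a := a :* (con 1 :+ p)) refl (r ^ x) P ⟩
    r ^ x * suc P ∎

-- (1 + 1/P)^k ≤ P / (P - k), in the form (P+1)^k (P - k) ≤ P^(k+1).
succ-pow≤ : ∀ P k → suc P ^ k * (P ∸ k) ≤ P ^ suc k
succ-pow≤ P zero = ≤-reflexive (trans (+-identityʳ P) (sym (*-identityʳ P)))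
succ-pow≤ P (suc k) = begin
  suc P * suc P ^ k * (P ∸ suc k)
    ≡⟨ solve 3 (λ a b c → a :* b :* c := b :* (a :* c)) refl (suc P) (suc P ^ k) (P ∸ suc k) ⟩
  suc P ^ k * (suc P * (P ∸ suc k)) ≤⟨ *-monoʳ-≤ (suc P ^ k) (shift P k) ⟩
  suc P ^ k * (P * (P ∸ k))
    ≡⟨ solve 3 (λ a p c → a :* (p :* c) := p :* (a :* c)) refl (suc P ^ k) P (P ∸ k) ⟩
  P * (suc P ^ k * (P ∸ k))         ≤⟨ *-monoʳ-≤ P (succ-pow≤ P k) ⟩
  P * P ^ suc k ∎
  where
  open ≤-Reasoning
  shift : ∀ P k → suc P * (P ∸ suc k) ≤ P * (P ∸ k)
  shift zero k = z≤n
  shift (suc P) zero = ≤-trans (n≤1+n _)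
    (≤-reflexive (solve 1 (λ p → con 1 :+ (con 2 :+ p) :* p := (con 1 :+ p) :* (con 1 :+ p)) refl P))
  shift (suc P) (suc k) = +-mono-≤ (∸-monoʳ-≤ P (n≤1+n k)) (shift P k)

σ-large-factors : ∀ x → 1 ≤ x → (P : ℕ) .{{_ : NonZero P}} (rs : List ℕ) → All Prime rs → All (P ≤_) rs →
  σ x (product rs) * (P ∸ length rs) ≤ product rs ^ x * P
σ-large-factors x x≥1 P rs prs P≤rs = *-cancelʳ-≤ _ _ (P ^ ℓ) {{m^n≢0 P ℓ}} (begin
  S * (P ∸ ℓ) * P ^ ℓ         ≡⟨ solve 3 (λ s a b → s :* a :* b := s :* b :* a) refl S (P ∸ ℓ) (P ^ ℓ) ⟩
  S * P ^ ℓ * (P ∸ ℓ)         ≤⟨ *-monoˡ-≤ (P ∸ ℓ) (σ-product≤ x x≥1 P rs prs P≤rs) ⟩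
  T * suc P ^ ℓ * (P ∸ ℓ)     ≡⟨ *-assoc T (suc P ^ ℓ) (P ∸ ℓ) ⟩
  T * (suc P ^ ℓ * (P ∸ ℓ))   ≤⟨ *-monoʳ-≤ T (succ-pow≤ P ℓ) ⟩
  T * (P * P ^ ℓ)             ≡⟨ sym (*-assoc T P (P ^ ℓ)) ⟩
  T * P * P ^ ℓ ∎)
  where
  open ≤-Reasoning
  ℓ = length rs
  S = σ x (product rs)
  T = product rs ^ x
  instance _ = productOfPrimes≢0 prs

mersenne : ℕ → ℕ
mersenne q = 2 ^ q ∸ 1

mersenne-+ : ∀ a b → mersenne (a + b) ≡ 2 ^ a * mersenne b + mersenne a
mersenne-+ a b =
  trans (cong (_∸ 1) (^-distribˡ-+-* 2 a b)) (expand (2 ^ a) (2 ^ b) {{m^n≢0 2 a}} {{m^n≢0 2 b}})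
  where
  expand : ∀ X Y → .{{NonZero X}} → .{{NonZero Y}} → X * Y ∸ 1 ≡ X * (Y ∸ 1) + (X ∸ 1)
  expand (suc X) (suc Y) = solve 2 (λ X Y → Y :+ X :* (con 1 :+ Y) := (con 1 :+ X) :* Y :+ X) refl X Y

mersenne-nonZero : ∀ q → 1 ≤ q → NonZero (mersenne q)
mersenne-nonZero q 1≤q = >-nonZero (∸-monoˡ-≤ 1 (^-monoʳ-≤ 2 1≤q))

mersenne<2^ : ∀ q → mersenne q < 2 ^ q
mersenne<2^ q = ∸-monoʳ-< (s≤s z≤n) (m^n>0 2 q)

2^j∸2^i : ∀ i j → i ≤ j → 2 ^ j ∸ 2 ^ i ≡ 2 ^ i * mersenne (j ∸ i)
2^j∸2^i i j i≤j = begin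
  2 ^ j ∸ 2 ^ i                   ≡⟨ cong₂ _∸_ 2^j≡ (sym (*-identityʳ (2 ^ i))) ⟩
  2 ^ i * 2 ^ (j ∸ i) ∸ 2 ^ i * 1 ≡⟨ sym (*-distribˡ-∸ (2 ^ i) (2 ^ (j ∸ i)) 1) ⟩
  2 ^ i * mersenne (j ∸ i) ∎
  where
  open ≡-Reasoning
  2^j≡ : 2 ^ j ≡ 2 ^ i * 2 ^ (j ∸ i)
  2^j≡ = trans (cong (2 ^_) (sym (m+[n∸m]≡n i≤j))) (^-distribˡ-+-* 2 i (j ∸ i))

prime∤1 : ∀ {r} → Prime r → ¬ r ∣ 1
prime∤1 pr r∣1 = ¬prime[1] (subst Prime (∣1⇒≡1 r∣1) pr)

-- A prime factor of 2^q - 1 divides no 2^i with i ≤ q (it would divide 2^q - (2^q - 1) = 1).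
mersenne-divisor∤2^ : ∀ {r q i} → Prime r → r ∣ mersenne q → i ≤ q → ¬ r ∣ 2 ^ i
mersenne-divisor∤2^ {r} {q} {i} pr r∣M i≤q r∣2^i = prime∤1 pr (∣m+n∣m⇒∣n r∣M+1 r∣M)
  where
  2^i∣2^q : 2 ^ i ∣ 2 ^ q
  2^i∣2^q = divides (2 ^ (q ∸ i))
    (trans (cong (2 ^_) (sym (m∸n+n≡m i≤q))) (^-distribˡ-+-* 2 (q ∸ i) i))
  r∣M+1 : r ∣ mersenne q + 1
  r∣M+1 = subst (r ∣_) (sym (m∸n+n≡m (m^n>0 2 q))) (∣-trans r∣2^i 2^i∣2^q)

mersenne-odd : ∀ {q} → 1 ≤ q → ¬ 2 ∣ mersenne q
mersenne-odd 1≤q 2∣M = mersenne-divisor∤2^ prime[2] 2∣M 1≤q ∣-refl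

-- For fixed r, the exponents n with r ∣ 2^n - 1 are closed under sums,
-- differences and multiples; by Bézout, two coprime exponents force r ∣ 1.
module MersenneExponents (r : ℕ) where

  Exponent : ℕ → Set
  Exponent n = r ∣ mersenne n

  +-closed : ∀ a b → Exponent a → Exponent b → Exponent (a + b)
  +-closed a b ea eb = subst (r ∣_) (sym (mersenne-+ a b)) (∣m∣n⇒∣m+n (∣n⇒∣m*n (2 ^ a) eb) ea)

  ∸-closed : ∀ a b → Exponent (a + b) → Exponent b → Exponent a
  ∸-closed a b eab eb = ∣m+n∣m⇒∣n (subst (r ∣_) (mersenne-+ a b) eab) (∣n⇒∣m*n (2 ^ a) eb)

  *-closed : ∀ k a → Exponent a → Exponent (k * a)
  *-closed zero a ea = r ∣0
  *-closed (suc k) a ea = +-closed a (k * a) ea (*-closed k a ea)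

  coprime-exponents : ∀ a b → Coprime a b → Exponent a → Exponent b → r ∣ 1
  coprime-exponents a b cop ea eb with coprime-Bézout cop
  ... | Bézout.+- u v eq = ∸-closed 1 (v * b) (subst Exponent (sym eq) (*-closed u a ea)) (*-closed v b eb)
  ... | Bézout.-+ u v eq = ∸-closed 1 (u * a) (subst Exponent (sym eq) (*-closed v b eb)) (*-closed u a ea)

pred-< : ∀ {a r'} → a < suc r' → a ≢ 0 → pred a < r'
pred-< {zero} _ a≢0 = contradiction refl a≢0
pred-< {suc a} (s≤s a<r') _ = a<r'

residue-collision : ∀ r .{{_ : NonZero r}} (f : ℕ → ℕ) → (∀ i → i < r → f i % r ≢ 0) →
  ∃₂ λ i j → i < j × j < r × f i % r ≡ f j % r
residue-collision r@(suc r') f nonzero =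
  let (i , j , i<j , gi≡gj) = pigeonhole (n<1+n r') g in
  toℕ i , toℕ j , i<j , toℕ<n j , residue≡ i j gi≡gj
  where
  residue : Fin r → ℕ
  residue i = f (toℕ i) % r
  residue≢0 : ∀ i → residue i ≢ 0
  residue≢0 i = nonzero (toℕ i) (toℕ<n i)
  -- the nonzero residues 1, …, r' are sent to Fin r' by pred
  g : Fin r → Fin r'
  g i = fromℕ< (pred-< (m%n<n (f (toℕ i)) r) (residue≢0 i))
  residue≡ : ∀ i j → g i ≡ g j → residue i ≡ residue j
  residue≡ i j gi≡gj = begin
    residue i            ≡⟨ sym (suc-pred (residue i) {{≢-nonZero (residue≢0 i)}}) ⟩
    suc (pred (residue i)) ≡⟨ cong suc (trans (sym (toℕ-fromℕ< _)) (trans (cong toℕ gi≡gj) (toℕ-fromℕ< _))) ⟩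
    suc (pred (residue j)) ≡⟨ suc-pred (residue j) {{≢-nonZero (residue≢0 j)}} ⟩
    residue j ∎
    where open ≡-Reasoning

%-equal⇒∣∸ : ∀ r A B → .{{_ : NonZero r}} → A % r ≡ B % r → A ≤ B → r ∣ B ∸ A
%-equal⇒∣∸ r A B A≡B A≤B = divides (B / r ∸ A / r) (begin
  B ∸ A                                     ≡⟨ cong₂ _∸_ (m≡m%n+[m/n]*n B r) (m≡m%n+[m/n]*n A r) ⟩
  (B % r + B / r * r) ∸ (A % r + A / r * r) ≡⟨ cong (λ z → (B % r + B / r * r) ∸ (z + A / r * r)) A≡B ⟩
  (B % r + B / r * r) ∸ (B % r + A / r * r) ≡⟨ [m+n]∸[m+o]≡n∸o (B % r) _ _ ⟩
  B / r * r ∸ A / r * r                     ≡⟨ sym (*-distribʳ-∸ r (B / r) (A / r)) ⟩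
  (B / r ∸ A / r) * r ∎)
  where open ≡-Reasoning

mersenne-period : ∀ r q → Prime r → r ∣ mersenne q → r ≤ q → ∃ λ t → 1 ≤ t × t < r × r ∣ mersenne t
mersenne-period r q pr r∣M r≤q =
  let (i , j , i<j , j<r , res≡) = residue-collision r (2 ^_) 2^i%r≢0 in
  j ∸ i , m<n⇒0<n∸m i<j , ≤-<-trans (m∸n≤m j i) j<r , period i j i<j (≤-trans (<⇒≤ j<r) r≤q) res≡
  where
  instance _ = prime⇒nonZero pr
  2^i%r≢0 : ∀ i → i < r → 2 ^ i % r ≢ 0
  2^i%r≢0 i i<r 2^i%r≡0 = mersenne-divisor∤2^ pr r∣M (≤-trans (<⇒≤ i<r) r≤q) (m%n≡0⇒n∣m (2 ^ i) r 2^i%r≡0)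
  -- r ∣ 2^j - 2^i = 2^i (2^(j-i) - 1) and r ∤ 2^i
  period : ∀ i j → i < j → j ≤ q → 2 ^ i % r ≡ 2 ^ j % r → r ∣ mersenne (j ∸ i)
  period i j i<j j≤q res≡
    with euclidsLemma (2 ^ i) (mersenne (j ∸ i)) pr
           (subst (r ∣_) (2^j∸2^i i j (<⇒≤ i<j)) (%-equal⇒∣∸ r (2 ^ i) (2 ^ j) res≡ (^-monoʳ-≤ 2 (<⇒≤ i<j))))
  ... | inj₁ r∣2^i = contradiction r∣2^i (mersenne-divisor∤2^ pr r∣M (≤-trans (<⇒≤ i<j) j≤q))
  ... | inj₂ r∣M' = r∣M'

-- Every prime factor r of 2^q - 1, q prime, exceeds q: otherwise the period t < r ≤ q
-- would be coprime to q.
mersenne-prime-factor> : ∀ q r → Prime q → Prime r → r ∣ mersenne q → q < r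
mersenne-prime-factor> q r pq pr r∣M = ≰⇒> r≰q
  where
  r≰q : ¬ r ≤ q
  r≰q r≤q =
    let (t , 1≤t , t<r , r∣Mt) = mersenne-period r q pr r∣M r≤q in
    prime∤1 pr (MersenneExponents.coprime-exponents r q t
      (prime⇒coprime pq {{>-nonZero 1≤t}} (<-≤-trans t<r r≤q)) r∣M r∣Mt)

few-factors : ∀ C P ℓ q → 2 ^ C ≤ P → P ^ ℓ < 2 ^ q → C * ℓ < q
few-factors C P ℓ q 2^C≤P P^ℓ<2^q = ≰⇒> (λ q≤Cℓ → <⇒≱ P^ℓ<2^q (begin
  2 ^ q       ≤⟨ ^-monoʳ-≤ 2 q≤Cℓ ⟩
  2 ^ (C * ℓ) ≡⟨ sym (^-*-assoc 2 C ℓ) ⟩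
  (2 ^ C) ^ ℓ ≤⟨ ^-monoˡ-≤ ℓ 2^C≤P ⟩
  P ^ ℓ ∎))
  where open ≤-Reasoning

ratio-bound : ∀ B S T P ℓ → .{{NonZero P}} → suc B * ℓ ≤ P → S * (P ∸ ℓ) ≤ T * P → B * S ≤ suc B * T
ratio-bound B S T P ℓ Bℓ≤P SP≤TP = *-cancelˡ-≤ P (begin
  P * (B * S)           ≡⟨ solve 3 (λ p b s → p :* (b :* s) := b :* p :* s) refl P B S ⟩
  B * P * S             ≤⟨ *-monoˡ-≤ S BP≤ ⟩
  suc B * (P ∸ ℓ) * S   ≡⟨ solve 3 (λ b a s → b :* a :* s := b :* (s :* a)) refl (suc B) (P ∸ ℓ) S ⟩
  suc B * (S * (P ∸ ℓ)) ≤⟨ *-monoʳ-≤ (suc B) SP≤TP ⟩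
  suc B * (T * P)       ≡⟨ solve 3 (λ b t p → b :* (t :* p) := p :* (b :* t)) refl (suc B) T P ⟩
  P * (suc B * T) ∎)
  where
  open ≤-Reasoning
  BP≤ : B * P ≤ suc B * (P ∸ ℓ)
  BP≤ = begin
    B * P                 ≡⟨ sym (m+n∸m≡n P (B * P)) ⟩
    suc B * P ∸ P         ≤⟨ ∸-monoʳ-≤ (suc B * P) Bℓ≤P ⟩
    suc B * P ∸ suc B * ℓ ≡⟨ sym (*-distribˡ-∸ (suc B) P ℓ) ⟩
    suc B * (P ∸ ℓ) ∎

σ-mersenne≤ : ∀ x q B → 1 ≤ x → Prime q → 2 ^ suc B ≤ q → B * σ x (mersenne q) ≤ suc B * mersenne q ^ x
σ-mersenne≤ x q B x≥1 pq 2^B≤q = ratio-bound B (σ x M) (M ^ x) P ℓ ℓ-small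
  (subst (λ m → σ x m * (P ∸ ℓ) ≤ m ^ x * P) (sym M≡) (σ-large-factors x x≥1 P rs prs P≤rs))
  where
  M = mersenne q
  instance _ = mersenne-nonZero q (≤-trans (m^n>0 2 (suc B)) 2^B≤q)
  factorisation = factorise M
  rs = PrimeFactorisation.factors factorisation
  prs = PrimeFactorisation.factorsPrime factorisation
  M≡ : M ≡ product rs
  M≡ = PrimeFactorisation.isFactorisation factorisation
  P = suc q
  ℓ = length rs
  P≤rs : All (P ≤_) rs
  P≤rs = All.tabulate (λ r∈rs → mersenne-prime-factor> q _ pq (All.lookup prs r∈rs)
    (subst (_ ∣_) (sym M≡) (∈⇒∣product r∈rs)))
  ℓ-small : suc B * ℓ ≤ P
  ℓ-small = m<n⇒m≤1+n (few-factors (suc B) P ℓ q (≤-trans 2^B≤q (n≤1+n q))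
    (≤-<-trans (subst (P ^ ℓ ≤_) (sym M≡) (product≥ P rs P≤rs)) (mersenne<2^ q)))

∸*< : ∀ X Y B D → Y * D < X * D + B → X ≤ Y → (Y ∸ X) * D < B
∸*< X Y B D YD<XD+B X≤Y = +-cancelˡ-< (X * D) _ _ (subst (_< X * D + B) YD≡ YD<XD+B)
  where
  YD≡ : Y * D ≡ X * D + (Y ∸ X) * D
  YD≡ = trans (sym (m+[n∸m]≡n (*-monoˡ-≤ D X≤Y))) (cong (X * D +_) (sym (*-distribʳ-∸ D Y X)))

∣⊖∣*< : ∀ X Y B D → X * D < Y * D + B → Y * D < X * D + B → Z.∣ X Z.⊖ Y ∣ * D < B
∣⊖∣*< X Y B D XD< YD< with X ≤? Y
... | yes X≤Y = subst (λ z → z * D < B) (sym (ZP.∣⊖∣-≤ X≤Y)) (∸*< X Y B D YD< X≤Y)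
... | no X≰Y = subst (λ z → z * D < B) (sym (trans (ZP.∣m⊖n∣≡∣n⊖m∣ X Y) (ZP.∣⊖∣-≤ Y≤X))) (∸*< Y X B D XD< Y≤X)
  where
  Y≤X = <⇒≤ (≰⇒> X≰Y)

-- |a/b - c/d| < ε as soon as |a d - c b| · D < b d, where D is the denominator of ε
-- (so ε ≥ 1/D); the hypotheses state the latter as two inequalities in ℕ.
frac-close : ∀ a b c d (ε : ℚ) → .{{_ : NonZero b}} → .{{_ : NonZero d}} → 0ℚ Q.< ε →
  a * d * Q.↧ₙ ε < c * b * Q.↧ₙ ε + b * d → c * b * Q.↧ₙ ε < a * d * Q.↧ₙ ε + b * d →
  Q.∣ frac a b Q.- frac c d ∣ Q.< ε
frac-close a (suc b') c (suc d') ε@(mkℚ (Z.+[1+ k ]) e _) _ h₁ h₂ =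
  QP.toℚᵘ-cancel-< (ℚᵘP.<-respˡ-≃ (ℚᵘP.≃-sym toℚᵘ-diff) diff<ε)
  where
  b = suc b'
  d = suc d'
  ua = ℚᵘ.mkℚᵘ (Z.+ a) b'
  uc = ℚᵘ.mkℚᵘ (Z.+ c) d'
  toℚᵘ-diff : Q.toℚᵘ (Q.∣ frac a b Q.- frac c d ∣) ℚᵘ.≃ ℚᵘ.∣ ua ℚᵘ.- uc ∣
  toℚᵘ-diff = ℚᵘP.≃-trans (QP.toℚᵘ-homo-∣-∣ (frac a b Q.- frac c d)) (ℚᵘP.∣-∣-cong
    (ℚᵘP.≃-trans (QP.toℚᵘ-homo-+ (frac a b) (Q.- frac c d))
      (ℚᵘP.+-cong (QP.toℚᵘ-fromℚᵘ ua)
        (ℚᵘP.≃-trans (QP.toℚᵘ-homo‿- (frac c d)) (ℚᵘP.-‿cong (QP.toℚᵘ-fromℚᵘ uc))))))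
  numerator≡ : Z.+ a Z.* Z.+ d Z.+ (Z.- Z.+ c) Z.* Z.+ b ≡ (a * d) Z.⊖ (c * b)
  numerator≡ = trans
    (cong₂ Z._+_ (sym (ZP.pos-* a d))
      (trans (sym (ZP.neg-distribˡ-* (Z.+ c) (Z.+ b))) (cong Z.-_ (sym (ZP.pos-* c b)))))
    (ZP.m-n≡m⊖n (a * d) (c * b))
  cross : Z.∣ (a * d) Z.⊖ (c * b) ∣ * suc e < suc k * (b * d)
  cross = <-≤-trans (∣⊖∣*< (a * d) (c * b) (b * d) (suc e) h₁ h₂) (m≤n*m (b * d) (suc k))
  diff<ε : ℚᵘ.∣ ua ℚᵘ.- uc ∣ ℚᵘ.< ℚᵘ.mkℚᵘ (Z.+[1+ k ]) e
  diff<ε = ℚᵘ.*<* (subst₂ Z._<_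
    (trans (cong (λ z → Z.+ (Z.∣ z ∣ * suc e)) (sym numerator≡))
      (ZP.pos-* (Z.∣ Z.+ a Z.* Z.+ d Z.+ (Z.- Z.+ c) Z.* Z.+ b ∣) (suc e)))
    (ZP.pos-* (suc k) (b * d)) (Z.+<+ cross))
frac-close a (suc b') c (suc d') (mkℚ (Z.+ zero) e _) (Q.*<* (Z.+<+ ())) h₁ h₂
frac-close a (suc b') c (suc d') (mkℚ (Z.-[1+ n ]) e _) (Q.*<* ()) h₁ h₂

n<2^n : ∀ n → n < 2 ^ n
n<2^n zero = s≤s z≤n
n<2^n (suc n) = begin-strict
  suc n         ≤⟨ n<2^n n ⟩
  2 ^ n         <⟨ m<m+n (2 ^ n) (subst (0 <_) (sym (+-identityʳ (2 ^ n))) (m^n>0 2 n)) ⟩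
  2 ^ n + (2 ^ n + 0) ∎
  where open ≤-Reasoning

σ-N : ∀ x q → 1 ≤ q → σ x (N q) ≡ geom (2 ^ x) q * σ x (mersenne q)
σ-N x q 1≤q = trans (σ-2^a*odd x (q ∸ 1) (mersenne q) (mersenne-odd 1≤q))
  (cong (λ n → geom (2 ^ x) n * σ x (mersenne q)) (suc-pred q))
  where
  instance
    _ = mersenne-nonZero q 1≤q
    _ = >-nonZero 1≤q

N-^ : ∀ x q → N q ^ x ≡ (2 ^ x) ^ (q ∸ 1) * mersenne q ^ x
N-^ x q = trans (*-^ (2 ^ (q ∸ 1)) (mersenne q) x) (cong (_* mersenne q ^ x) (begin
  (2 ^ (q ∸ 1)) ^ x ≡⟨ ^-*-assoc 2 (q ∸ 1) x ⟩
  2 ^ ((q ∸ 1) * x) ≡⟨ cong (2 ^_) (*-comm (q ∸ 1) x) ⟩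
  2 ^ (x * (q ∸ 1)) ≡⟨ sym (^-*-assoc 2 x (q ∸ 1)) ⟩
  (2 ^ x) ^ (q ∸ 1) ∎))
  where open ≡-Reasoning

-- Upper half of the final estimate, with W = 2^x = U + 1, G = geom W q, V = W^(q-1),
-- S = σ_x(M), T = M^x:  from S/T ≤ 1 + 1/(2D+1) and G < W V / U,
--   G S U D < W V T D + V T U.
upper-estimate : ∀ W U G S T V D → W ≡ suc U → 1 ≤ U → 1 ≤ T → 1 ≤ V → U * G + 1 ≡ W * V →
  suc (2 * D) * S ≤ (2 + 2 * D) * T → G * S * U * D < W * (V * T) * D + V * T * U
upper-estimate _ U G S T V D refl 1≤U 1≤T 1≤V UG+1≡ S≤ = *-cancelˡ-< B _ _ (begin-strict
  B * (G * S * U * D)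
    ≡⟨ solve 5 (λ b g s u d → b :* (g :* s :* u :* d) := (g :* u :* d) :* (b :* s)) refl B G S U D ⟩
  (G * U * D) * (B * S)                  ≤⟨ *-monoʳ-≤ (G * U * D) S≤ ⟩
  (G * U * D) * ((2 + 2 * D) * T)
    ≡⟨ solve 4 (λ g u d t → (g :* u :* d) :* ((con 2 :+ con 2 :* d) :* t) := (con 1 :+ con 2 :* d) :* (g :* u :* d :* t) :+ g :* u :* d :* t) refl G U D T ⟩
  B * (G * U * D * T) + G * U * D * T    <⟨ +-monoʳ-< (B * (G * U * D * T)) GUDT< ⟩
  B * (G * U * D * T) + B * (V * T * U)  ≤⟨ +-monoˡ-≤ (B * (V * T * U)) (*-monoʳ-≤ B GUDT≤) ⟩
  B * ((U * G + 1) * T * D) + B * (V * T * U) ≡⟨ cong (λ z → B * (z * T * D) + B * (V * T * U)) UG+1≡ ⟩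
  B * (suc U * V * T * D) + B * (V * T * U)
    ≡⟨ solve 6 (λ p a v t d u → p :* (a :* v :* t :* d) :+ p :* (v :* t :* u) := p :* (a :* (v :* t) :* d :+ v :* t :* u)) refl B (suc U) V T D U ⟩
  B * (suc U * (V * T) * D + V * T * U) ∎)
  where
  open ≤-Reasoning
  B = suc (2 * D)
  instance _ = >-nonZero 1≤U
  instance _ = >-nonZero 1≤T
  instance _ = >-nonZero 1≤V
  G≤2V : G ≤ 2 * V
  G≤2V = <⇒≤ (*-cancelˡ-< U G (2 * V) (begin-strict
    U * G         <⟨ m<m+n (U * G) (s≤s z≤n) ⟩
    U * G + 1     ≡⟨ UG+1≡ ⟩
    suc U * V     ≡⟨ +-comm V (U * V) ⟩
    U * V + V     ≤⟨ +-monoʳ-≤ (U * V) (m≤n*m V U) ⟩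
    U * V + U * V ≡⟨ solve 2 (λ u v → u :* v :+ u :* v := u :* (con 2 :* v)) refl U V ⟩
    U * (2 * V) ∎))
  GD< : G * D < B * V
  GD< = begin-strict
    G * D             ≤⟨ *-monoˡ-≤ D G≤2V ⟩
    2 * V * D         <⟨ m<m+n (2 * V * D) (m^n>0 V 1) ⟩
    2 * V * D + V * 1 ≡⟨ solve 2 (λ v d → con 2 :* v :* d :+ v :* con 1 := (con 1 :+ con 2 :* d) :* v) refl V D ⟩
    B * V ∎
  GUDT< : G * U * D * T < B * (V * T * U)
  GUDT< = begin-strict
    G * U * D * T   ≡⟨ solve 4 (λ g u d t → g :* u :* d :* t := (t :* u) :* (g :* d)) refl G U D T ⟩
    (T * U) * (G * D) <⟨ *-monoʳ-< (T * U) {{m*n≢0 T U}} GD< ⟩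
    (T * U) * (B * V) ≡⟨ solve 4 (λ t u p v → (t :* u) :* (p :* v) := p :* (v :* t :* u)) refl T U B V ⟩
    B * (V * T * U) ∎
  GUDT≤ : G * U * D * T ≤ (U * G + 1) * T * D
  GUDT≤ = begin
    G * U * D * T       ≡⟨ solve 4 (λ g u d t → g :* u :* d :* t := u :* g :* t :* d) refl G U D T ⟩
    U * G * T * D       ≤⟨ *-monoˡ-≤ D (*-monoˡ-≤ T (m≤m+n (U * G) 1)) ⟩
    (U * G + 1) * T * D ∎

lower-estimate : ∀ W U G S T V D → W ≡ suc U → 1 ≤ U → 1 ≤ T → U * G + 1 ≡ W * V → D < V → T ≤ S →
  W * (V * T) * D < G * S * U * D + V * T * U
lower-estimate _ U G S T V D refl 1≤U 1≤T UG+1≡ D<V T≤S = begin-strict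
  suc U * (V * T) * D   ≡⟨ solve 4 (λ w v t d → w :* (v :* t) :* d := (w :* v) :* t :* d) refl (suc U) V T D ⟩
  (suc U * V) * T * D   ≡⟨ cong (λ z → z * T * D) (sym UG+1≡) ⟩
  (U * G + 1) * T * D
    ≡⟨ solve 4 (λ u g t d → (u :* g :+ con 1) :* t :* d := g :* t :* u :* d :+ t :* d) refl U G T D ⟩
  G * T * U * D + T * D ≤⟨ +-monoˡ-≤ (T * D) (*-monoˡ-≤ D (*-monoˡ-≤ U (*-monoʳ-≤ G T≤S))) ⟩
  G * S * U * D + T * D <⟨ +-monoʳ-< (G * S * U * D) TD< ⟩
  G * S * U * D + V * T * U ∎
  where
  open ≤-Reasoning
  TD< : T * D < V * T * U
  TD< = begin-strict
    T * D     <⟨ *-monoʳ-< T {{>-nonZero 1≤T}} D<V ⟩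
    T * V     ≡⟨ *-comm T V ⟩
    V * T     ≤⟨ m≤m*n (V * T) U {{>-nonZero 1≤U}} ⟩
    V * T * U ∎

I-N-close : ∀ x q (ε : ℚ) → 1 ≤ x → Prime q → 0ℚ Q.< ε → 2 ^ (2 + 2 * Q.↧ₙ ε) ≤ q →
  Q.∣ I x (N q) Q.- frac (2 ^ x) (2 ^ x ∸ 1) ∣ Q.< ε
I-N-close x q ε x≥1 pq ε>0 2^B≤q = frac-close (σ x (N q)) (N q ^ x) W U ε ε>0
  (subst₂ (λ σN Nx → σN * U * D < W * Nx * D + Nx * U) (sym (σ-N x q 1≤q)) (sym (N-^ x q))
    (upper-estimate W U G S T V D W≡ 1≤U 1≤T 1≤V UG+1≡ (σ-mersenne≤ x q (suc (2 * D)) x≥1 pq 2^B≤q)))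
  (subst₂ (λ σN Nx → W * Nx * D < σN * U * D + Nx * U) (sym (σ-N x q 1≤q)) (sym (N-^ x q))
    (lower-estimate W U G S T V D W≡ 1≤U 1≤T UG+1≡ D<V (^≤σ x M)))
  where
  D = Q.↧ₙ ε
  W = 2 ^ x
  U = W ∸ 1
  M = mersenne q
  G = geom W q
  S = σ x M
  T = M ^ x
  V = W ^ (q ∸ 1)
  1≤q : 1 ≤ q
  1≤q = ≤-trans (m^n>0 2 (2 + 2 * D)) 2^B≤q
  1≤U : 1 ≤ U
  1≤U = ∸-monoˡ-≤ 1 (^-monoʳ-≤ 2 x≥1)
  instance
    _ = mersenne-nonZero q 1≤q
    _ = >-nonZero 1≤U
    _ = m^n≢0 (N q) x {{m*n≢0 (2 ^ (q ∸ 1)) M {{m^n≢0 2 (q ∸ 1)}}}}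
  1≤T : 1 ≤ T
  1≤T = m^n>0 M x
  1≤V : 1 ≤ V
  1≤V = m^n>0 W {{m^n≢0 2 x}} (q ∸ 1)
  W≡ : W ≡ suc U
  W≡ = sym (trans (+-comm 1 U) (m∸n+n≡m (m^n>0 2 x)))
  UG+1≡ : U * G + 1 ≡ W * V
  UG+1≡ = trans (geom-closed W U q W≡) (cong (W ^_) (sym (suc-pred q {{>-nonZero 1≤q}})))
  -- D + 2 ≤ 2 + 2D < 2^(2+2D) ≤ q, so D < q - 1 < 2^(q-1) ≤ V
  D<V : D < V
  D<V = begin-strict
    D         <⟨ ∸-monoˡ-≤ 1 (≤-trans (s≤s (s≤s (m≤m+n D (D + 0)))) (≤-trans (<⇒≤ (n<2^n (2 + 2 * D))) 2^B≤q)) ⟩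
    q ∸ 1     <⟨ n<2^n (q ∸ 1) ⟩
    2 ^ (q ∸ 1) ≤⟨ ^-monoˡ-≤ (q ∸ 1) (^-monoʳ-≤ 2 x≥1) ⟩
    V ∎
    where open ≤-Reasoning

strictly-increasing⇒≥ : ∀ (f : ℕ → ℕ) → (∀ k → f k < f (suc k)) → ∀ k → k ≤ f k
strictly-increasing⇒≥ f inc zero = z≤n
strictly-increasing⇒≥ f inc (suc k) = ≤-trans (s≤s (strictly-increasing⇒≥ f inc k)) (inc k)

-- Given ε with denominator D, every k ≥ 2^(2+2D) has p k ≥ k ≥ 2^(2+2D), so
-- the explicit estimate applies to the prime p k.
mainTheorem11 : (x : ℕ) → x ≥ 1 → (p : ℕ → ℕ) → IsPrimeEnumeration p →
    ConvergesTo (λ k → I x (N (p k))) (frac (2 ^ x) (2 ^ x ∸ 1))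
mainTheorem11 x x≥1 p (p-prime , p-increasing , _) ε ε>0 =
  2 ^ (2 + 2 * Q.↧ₙ ε) ,
  λ k K≤k → I-N-close x (p k) ε x≥1 (p-prime k) ε>0 (≤-trans K≤k (strictly-increasing⇒≥ p p-increasing k))
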